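{- Let $n\ge 1$ and $0\le m\le\binom n2$. Define $F(d_0)=\frac12(n-d_0)(n-d_0+1)$ and $$d_*=\left\lceil n+\frac12-\frac12\sqrt{8m+1}\right\rceil,$$ and $$D^{EM}_{upper}(n,m)=(m-F(d_*))(d_*-1)+\frac16(n-d_*)\bigl(n^2+(n+3)d_*-2d_*^2-1\bigr).$$ Then for every simple undirected graph $G$ with $n$ vertices and $m$ edges and every linear arrangement of its vertices, the sum of edge lengths satisfies $D\le D^{EM}_{upper}(n,m)$. Moreover $D^{EM}_{upper}(n,0)=0$ and $D^{EM}_{upper}(n,\binom n2)=\frac16(n+1)n(n-1)$.
   Context: A linear arrangement of the vertex set $V$ ($|V|=n$) is a bijection $\pi:V\to\{1,\dots,n\}$; the length of an edge $\{u,v\}$ is $|\pi(u)-\pi(v)|$; $D$ is the sum of the lengths of all edges. -}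

module Defs where

open import Data.Nat as ℕ using (ℕ; zero; suc; _∸_; ∣_-_∣; _≤?_)
open import Data.Bool using (Bool; true; false; if_then_else_)
open import Data.Fin using (Fin; toℕ)
open import Data.List using (List; []; _∷_; length; map; concatMap; filter; allFin)
open import Data.Nat.ListAction using (sum)
open import Data.Product using (_×_; _,_)
open import Data.Integer using (+_)
open import Data.Rational using (ℚ; _/_; _+_; _*_; _-_)
open import Function.Bundles using (Inverse)
open import Data.Fin.Permutation using (Permutation′; _⟨$⟩ʳ_)
open import Relation.Binary.PropositionalEquality using (_≡_)
open import Relation.Nullary.Decidable using (⌊_⌋; _×-dec_)
open import Data.Bool.Properties using (_≟_)

record SimpleGraph (n : ℕ) : Set where
  field
    adj    : Fin n → Fin n → Bool
    sym    : ∀ i j → adj i j ≡ adj j i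
    irrefl : ∀ i → adj i i ≡ false
open SimpleGraph public

edges : ∀ {n} → SimpleGraph n → List (Fin n × Fin n)
edges {n} G =
  filter (λ { (i , j) → (suc (toℕ i) ℕ.≤? toℕ j) ×-dec (adj G i j ≟ true) })
         (concatMap (λ i → map (λ j → (i , j)) (allFin n)) (allFin n))

numEdges : ∀ {n} → SimpleGraph n → ℕ
numEdges G = length (edges G)

-- A linear arrangement is a bijection from the vertices to the n positions
-- (positions 0..n-1 here instead of 1..n; edge lengths are unaffected).
LinearArrangement : ℕ → Set
LinearArrangement n = Permutation′ n

sumEdgeLengths : ∀ {n} → SimpleGraph n → LinearArrangement n → ℕ
sumEdgeLengths G π =
  sum (map (λ { (i , j) → ∣ toℕ (π ⟨$⟩ʳ i) - toℕ (π ⟨$⟩ʳ j) ∣ }) (edges G))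

ℕtoℚ : ℕ → ℚ
ℕtoℚ k = (+ k) / 1

leastFrom : (ℕ → Bool) → ℕ → ℕ → ℕ
leastFrom P k zero = k
leastFrom P k (suc fuel) = if P k then k else leastFrom P (suc k) fuel

-- d_* = ⌈ n + 1/2 - (1/2) √(8m+1) ⌉.
-- For an integer d ≤ n, n + 1/2 - √(8m+1)/2 ≤ d  iff  (2(n-d)+1)² ≤ 8m+1.
-- For 0 ≤ m ≤ C(n,2) the ceiling lies in {1,…,n}, and no negative integer
-- satisfies the condition, so d_* is the least d ∈ {0,…,n} with that property.
dStar : ℕ → ℕ → ℕ
dStar n m = leastFrom (λ d → ⌊ (2 ℕ.* (n ∸ d) ℕ.+ 1) ℕ.^ 2 ≤? 8 ℕ.* m ℕ.+ 1 ⌋) 0 n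

F : ℕ → ℕ → ℚ
F n d₀ = (+ 1 / 2) * (ℕtoℚ n - ℕtoℚ d₀) * (ℕtoℚ n - ℕtoℚ d₀ + ℕtoℚ 1)

DupperEM : ℕ → ℕ → ℚ
DupperEM n m =
  let d  = ℕtoℚ (dStar n m)
      nq = ℕtoℚ n
  in (ℕtoℚ m - F n (dStar n m)) * (d - ℕtoℚ 1)
     + (+ 1 / 6) * (nq - d)
         * (nq * nq + (nq + ℕtoℚ 3) * d - ℕtoℚ 2 * d * d - ℕtoℚ 1)

-- Put d = dStar n m = t + 1 and u = n - d. An edge of length ℓ satisfies ℓ ≤ t + (ℓ ∸ t), so
-- D ≤ m t + Σ_edges (ℓ ∸ t), and the excesses ℓ ∸ t summed over the edges are at most their sum
-- over all pairs of positions, Σ_{a<b<n} (b - a ∸ t) = u(u+1)(u+2)/6. For this d the expression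
-- D^EM_upper(n,m) simplifies exactly to m t + u(u+1)(u+2)/6; the hypothesis m ≤ C(n,2) only
-- serves to guarantee 1 ≤ d. As dStar n 0 = n and dStar n (C(n,2)) = 1, the two special values
-- are this closed form at (t,u) = (n-1,0) and (0,n-1).
module Submission where

module Threshold where

  open import Defs hiding (sym)
  open import Data.Nat using (ℕ; zero; suc; _+_; _*_; _∸_; _^_; _≤_; _<_; z<s; _≤?_)
  open import Data.Nat.Properties
  open import Data.Nat.Combinatorics using (_C_; nC1≡n; nCk+nC[k+1]≡[n+1]C[k+1])
  open import Data.Nat.Tactic.RingSolver using (solve-∀)
  open import Data.Bool using (Bool; true; false; if_then_else_)
  open import Data.Product using (_×_; _,_; ∃₂)
  open import Relation.Nullary.Decidable using (⌊_⌋; isYes≗does; dec-true; dec-false)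
  open import Relation.Binary.PropositionalEquality

  leastFrom-≥ : ∀ P k f → k ≤ leastFrom P k f
  leastFrom-≥ P k zero = ≤-refl
  leastFrom-≥ P k (suc f) with P k
  ... | true  = ≤-refl
  ... | false = ≤-trans (n≤1+n k) (leastFrom-≥ P (suc k) f)

  leastFrom-≤ : ∀ P k f → leastFrom P k f ≤ k + f
  leastFrom-≤ P k zero = ≤-reflexive (sym (+-identityʳ k))
  leastFrom-≤ P k (suc f) with P k
  ... | true  = m≤m+n k (suc f)
  ... | false = ≤-trans (leastFrom-≤ P (suc k) f) (≤-reflexive (sym (+-suc k f)))

  leastFrom-none : ∀ P k f → (∀ j → j < k + f → P j ≡ false) → leastFrom P k f ≡ k + f
  leastFrom-none P k zero none = sym (+-identityʳ k)
  leastFrom-none P k (suc f) none rewrite none k (m<m+n k z<s) =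
    trans (leastFrom-none P (suc k) f λ j j<1+k+f → none j (subst (j <_) (sym (+-suc k f)) j<1+k+f))
          (sym (+-suc k f))

  leastFrom-hit : ∀ P k f → P k ≡ true → leastFrom P k f ≡ k
  leastFrom-hit P k zero    _   = refl
  leastFrom-hit P k (suc f) Pk rewrite Pk = refl

  8*[1+k]C2+1≡[2k+1]² : ∀ k → 8 * (suc k C 2) + 1 ≡ (2 * k + 1) ^ 2
  8*[1+k]C2+1≡[2k+1]² zero    = refl
  8*[1+k]C2+1≡[2k+1]² (suc k) = begin
    8 * (suc (suc k) C 2) + 1         ≡⟨ cong (λ c → 8 * c + 1) (sym (nCk+nC[k+1]≡[n+1]C[k+1] (suc k) 1)) ⟩
    8 * (suc k C 1 + suc k C 2) + 1   ≡⟨ cong (λ c → 8 * (c + suc k C 2) + 1) (nC1≡n (suc k)) ⟩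
    8 * (suc k + suc k C 2) + 1       ≡⟨ regroup k (suc k C 2) ⟩
    8 * suc k + (8 * (suc k C 2) + 1) ≡⟨ cong (8 * suc k +_) (8*[1+k]C2+1≡[2k+1]² k) ⟩
    8 * suc k + (2 * k + 1) ^ 2       ≡⟨ square-step k ⟩
    (2 * suc k + 1) ^ 2               ∎
    where
    open ≡-Reasoning
    regroup : ∀ x c → 8 * (suc x + c) + 1 ≡ 8 * suc x + (8 * c + 1)
    regroup = solve-∀
    square-step : ∀ x →
      8 * suc x + (2 * x + 1) * ((2 * x + 1) * 1) ≡ (2 * suc x + 1) * ((2 * suc x + 1) * 1)
    square-step = solve-∀

  dStarCondition : ℕ → ℕ → ℕ → Bool
  dStarCondition n m d = ⌊ (2 * (n ∸ d) + 1) ^ 2 ≤? 8 * m + 1 ⌋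

  dStarCondition-0 : ∀ k m → m ≤ suc k C 2 → dStarCondition (suc k) m 0 ≡ false
  dStarCondition-0 k m m≤C =
    trans (isYes≗does _) (dec-false ((2 * suc k + 1) ^ 2 ≤? 8 * m + 1) (<⇒≱ 8m+1<[2n+1]²))
    where
    open ≤-Reasoning
    8m+1<[2n+1]² : 8 * m + 1 < (2 * suc k + 1) ^ 2
    8m+1<[2n+1]² = begin-strict
      8 * m + 1            ≤⟨ +-monoˡ-≤ 1 (*-monoʳ-≤ 8 m≤C) ⟩
      8 * (suc k C 2) + 1  ≡⟨ 8*[1+k]C2+1≡[2k+1]² k ⟩
      (2 * k + 1) ^ 2      <⟨ ^-monoˡ-< 2 (+-monoˡ-< 1 (*-monoʳ-< 2 (n<1+n k))) ⟩
      (2 * suc k + 1) ^ 2  ∎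

  dStar-from-1 : ∀ k m → m ≤ suc k C 2 → dStar (suc k) m ≡ leastFrom (dStarCondition (suc k) m) 1 k
  dStar-from-1 k m m≤C =
    cong (λ b → if b then 0 else leastFrom (dStarCondition (suc k) m) 1 k) (dStarCondition-0 k m m≤C)

  dStar-bounds : ∀ k m → m ≤ suc k C 2 → 1 ≤ dStar (suc k) m × dStar (suc k) m ≤ suc k
  dStar-bounds k m m≤C rewrite dStar-from-1 k m m≤C =
    leastFrom-≥ (dStarCondition (suc k) m) 1 k , leastFrom-≤ (dStarCondition (suc k) m) 1 k

  dStar-split : ∀ k m → m ≤ suc k C 2 → ∃₂ λ t u → dStar (suc k) m ≡ suc t × suc k ≡ suc t + u
  dStar-split k m m≤C with dStar (suc k) m | dStar-bounds k m m≤C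
  ... | suc t | _ , d≤n = t , suc k ∸ suc t , refl , sym (m+[n∸m]≡n d≤n)

  dStar-empty : ∀ n → dStar n 0 ≡ n
  dStar-empty n = leastFrom-none (dStarCondition n 0) 0 n λ j j<n →
    trans (isYes≗does _) (dec-false ((2 * (n ∸ j) + 1) ^ 2 ≤? 1) (<⇒≱ (^-monoˡ-< 2
      (+-monoˡ-< 1 (*-monoʳ-< 2 (m<n⇒0<n∸m j<n))))))

  dStar-complete : ∀ k → dStar (suc k) (suc k C 2) ≡ 1
  dStar-complete k = trans (dStar-from-1 k (suc k C 2) ≤-refl)
    (leastFrom-hit (dStarCondition (suc k) (suc k C 2)) 1 k
      (trans (isYes≗does _) (dec-true ((2 * k + 1) ^ 2 ≤? 8 * (suc k C 2) + 1)
        (≤-reflexive (sym (8*[1+k]C2+1≡[2k+1]² k))))))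

module ClosedForm where

  open import Defs hiding (sym)
  open import Data.Nat as ℕ using (suc)
  open import Data.Nat.Coprimality using (gcd≡1⇒coprime)
  open import Data.Nat.GCD using (gcd-zeroʳ)
  open import Data.Integer as ℤ using (+_)
  import Data.Integer.Properties as ℤ
  open import Data.Rational using (ℚ; mkℚ; _/_; _+_; _*_; _-_; 0ℚ; *≤*) renaming (_≤_ to _≤ℚ_)
  open import Data.Rational.Properties using (normalize-coprime; *-assoc; *-identityˡ; *-monoˡ-≤-nonNeg)
  open import Data.Rational.Solver using (module +-*-Solver)
  open import Data.Nat.Combinatorics using (_C_)
  open import Data.Nat.Properties using (+-identityʳ)
  open import Data.Nat.Tactic.RingSolver using (solve-∀)
  open import Relation.Binary.PropositionalEquality
  open Threshold using (dStar-empty; dStar-complete)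

  ℕtoℚ≡mkℚ : ∀ k → ℕtoℚ k ≡ mkℚ (+ k) 0 (gcd≡1⇒coprime (gcd-zeroʳ k))
  ℕtoℚ≡mkℚ k = normalize-coprime (gcd≡1⇒coprime (gcd-zeroʳ k))

  ℕtoℚ-+ : ∀ a b → ℕtoℚ (a ℕ.+ b) ≡ ℕtoℚ a + ℕtoℚ b
  ℕtoℚ-+ a b rewrite ℕtoℚ≡mkℚ a | ℕtoℚ≡mkℚ b =
    cong₂ (λ x y → (x ℤ.+ y) / 1) (sym (ℤ.*-identityʳ (+ a))) (sym (ℤ.*-identityʳ (+ b)))

  ℕtoℚ-* : ∀ a b → ℕtoℚ (a ℕ.* b) ≡ ℕtoℚ a * ℕtoℚ b
  ℕtoℚ-* a b rewrite ℕtoℚ≡mkℚ a | ℕtoℚ≡mkℚ b = cong (_/ 1) (ℤ.pos-* a b)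

  ℕtoℚ-mono-≤ : ∀ {a b} → a ℕ.≤ b → ℕtoℚ a ≤ℚ ℕtoℚ b
  ℕtoℚ-mono-≤ {a} {b} a≤b rewrite ℕtoℚ≡mkℚ a | ℕtoℚ≡mkℚ b =
    *≤* (subst₂ ℤ._≤_ (sym (ℤ.*-identityʳ (+ a))) (sym (ℤ.*-identityʳ (+ b))) (ℤ.+≤+ a≤b))

  ℕtoℚ-≤-sixth : ∀ a {b} → 6 ℕ.* a ℕ.≤ b → ℕtoℚ a ≤ℚ (+ 1 / 6) * ℕtoℚ b
  ℕtoℚ-≤-sixth a 6a≤b = subst (_≤ℚ _) sixth-of-6a (*-monoˡ-≤-nonNeg (+ 1 / 6) (ℕtoℚ-mono-≤ 6a≤b))
    where
    sixth-of-6a : (+ 1 / 6) * ℕtoℚ (6 ℕ.* a) ≡ ℕtoℚ a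
    sixth-of-6a = trans (cong ((+ 1 / 6) *_) (ℕtoℚ-* 6 a))
                        (trans (sym (*-assoc (+ 1 / 6) (ℕtoℚ 6) (ℕtoℚ a))) (*-identityˡ (ℕtoℚ a)))

  emUpperBound : ℚ → ℚ → ℚ → ℚ
  emUpperBound N D M = (M - (+ 1 / 2) * (N - D) * (N - D + ℕtoℚ 1)) * (D - ℕtoℚ 1)
    + (+ 1 / 6) * (N - D) * (N * N + (N + ℕtoℚ 3) * D - ℕtoℚ 2 * D * D - ℕtoℚ 1)

  emUpperBound-closedForm : ∀ M T U → emUpperBound (ℕtoℚ 1 + T + U) (ℕtoℚ 1 + T) M
    ≡ (+ 1 / 6) * (ℕtoℚ 6 * (M * T) + U * (U + ℕtoℚ 1) * (U + ℕtoℚ 2))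
  emUpperBound-closedForm = solve 3 (λ M T U →
      let N = con (ℕtoℚ 1) :+ T :+ U
          D = con (ℕtoℚ 1) :+ T
      in (M :- con (+ 1 / 2) :* (N :- D) :* (N :- D :+ con (ℕtoℚ 1))) :* (D :- con (ℕtoℚ 1))
         :+ con (+ 1 / 6) :* (N :- D)
            :* (N :* N :+ (N :+ con (ℕtoℚ 3)) :* D :- con (ℕtoℚ 2) :* D :* D :- con (ℕtoℚ 1))
      := con (+ 1 / 6) :* (con (ℕtoℚ 6) :* (M :* T) :+ U :* (U :+ con (ℕtoℚ 1)) :* (U :+ con (ℕtoℚ 2))))
    refl
    where open +-*-Solver

  DupperEM-closedForm : ∀ {n} m t u → n ≡ suc t ℕ.+ u → dStar n m ≡ suc t →
    DupperEM n m ≡ (+ 1 / 6) * ℕtoℚ (6 ℕ.* (m ℕ.* t) ℕ.+ u ℕ.* (u ℕ.+ 1) ℕ.* (u ℕ.+ 2))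
  DupperEM-closedForm m t u refl d≡ = begin
    DupperEM (suc t ℕ.+ u) m
      ≡⟨⟩
    emUpperBound (ℕtoℚ (suc t ℕ.+ u)) (ℕtoℚ (dStar (suc t ℕ.+ u) m)) (ℕtoℚ m)
      ≡⟨ cong₂ (λ N D → emUpperBound N D (ℕtoℚ m))
               (trans (ℕtoℚ-+ (suc t) u) (cong (_+ ℕtoℚ u) (ℕtoℚ-+ 1 t)))
               (trans (cong ℕtoℚ d≡) (ℕtoℚ-+ 1 t)) ⟩
    emUpperBound (ℕtoℚ 1 + ℕtoℚ t + ℕtoℚ u) (ℕtoℚ 1 + ℕtoℚ t) (ℕtoℚ m)
      ≡⟨ emUpperBound-closedForm (ℕtoℚ m) (ℕtoℚ t) (ℕtoℚ u) ⟩
    (+ 1 / 6) * (ℕtoℚ 6 * (ℕtoℚ m * ℕtoℚ t) + ℕtoℚ u * (ℕtoℚ u + ℕtoℚ 1) * (ℕtoℚ u + ℕtoℚ 2))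
      ≡⟨ cong ((+ 1 / 6) *_) (sym polynomial-homo) ⟩
    (+ 1 / 6) * ℕtoℚ (6 ℕ.* (m ℕ.* t) ℕ.+ u ℕ.* (u ℕ.+ 1) ℕ.* (u ℕ.+ 2)) ∎
    where
    open ≡-Reasoning
    polynomial-homo : ℕtoℚ (6 ℕ.* (m ℕ.* t) ℕ.+ u ℕ.* (u ℕ.+ 1) ℕ.* (u ℕ.+ 2))
                    ≡ ℕtoℚ 6 * (ℕtoℚ m * ℕtoℚ t) + ℕtoℚ u * (ℕtoℚ u + ℕtoℚ 1) * (ℕtoℚ u + ℕtoℚ 2)
    polynomial-homo = trans (ℕtoℚ-+ (6 ℕ.* (m ℕ.* t)) (u ℕ.* (u ℕ.+ 1) ℕ.* (u ℕ.+ 2))) (cong₂ _+_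
      (trans (ℕtoℚ-* 6 (m ℕ.* t)) (cong (ℕtoℚ 6 *_) (ℕtoℚ-* m t)))
      (trans (ℕtoℚ-* (u ℕ.* (u ℕ.+ 1)) (u ℕ.+ 2))
             (cong₂ _*_ (trans (ℕtoℚ-* u (u ℕ.+ 1)) (cong (ℕtoℚ u *_) (ℕtoℚ-+ u 1))) (ℕtoℚ-+ u 2))))

  DupperEM-empty : ∀ k → DupperEM (suc k) 0 ≡ 0ℚ
  DupperEM-empty k = DupperEM-closedForm 0 k 0 (cong suc (sym (+-identityʳ k))) (dStar-empty (suc k))

  DupperEM-complete : ∀ k →
    DupperEM (suc k) (suc k C 2) ≡ (+ 1 / 6) * ℕtoℚ (suc (suc k)) * ℕtoℚ (suc k) * ℕtoℚ k
  DupperEM-complete k = begin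
    DupperEM (suc k) (suc k C 2)
      ≡⟨ DupperEM-closedForm (suc k C 2) 0 k refl (dStar-complete k) ⟩
    (+ 1 / 6) * ℕtoℚ (6 ℕ.* ((suc k C 2) ℕ.* 0) ℕ.+ k ℕ.* (k ℕ.+ 1) ℕ.* (k ℕ.+ 2))
      ≡⟨ cong (λ x → (+ 1 / 6) * ℕtoℚ x) (reorder (suc k C 2) k) ⟩
    (+ 1 / 6) * ℕtoℚ (suc (suc k) ℕ.* suc k ℕ.* k)
      ≡⟨ cong ((+ 1 / 6) *_) (trans (ℕtoℚ-* (suc (suc k) ℕ.* suc k) k)
                                    (cong (_* ℕtoℚ k) (ℕtoℚ-* (suc (suc k)) (suc k)))) ⟩
    (+ 1 / 6) * (ℕtoℚ (suc (suc k)) * ℕtoℚ (suc k) * ℕtoℚ k)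
      ≡⟨ sym (*-assoc (+ 1 / 6) (ℕtoℚ (suc (suc k)) * ℕtoℚ (suc k)) (ℕtoℚ k)) ⟩
    (+ 1 / 6) * (ℕtoℚ (suc (suc k)) * ℕtoℚ (suc k)) * ℕtoℚ k
      ≡⟨ cong (_* ℕtoℚ k) (sym (*-assoc (+ 1 / 6) (ℕtoℚ (suc (suc k))) (ℕtoℚ (suc k)))) ⟩
    (+ 1 / 6) * ℕtoℚ (suc (suc k)) * ℕtoℚ (suc k) * ℕtoℚ k ∎
    where
    open ≡-Reasoning
    reorder : ∀ c x → 6 ℕ.* (c ℕ.* 0) ℕ.+ x ℕ.* (x ℕ.+ 1) ℕ.* (x ℕ.+ 2) ≡ suc (suc x) ℕ.* suc x ℕ.* x
    reorder = solve-∀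

module EdgeLengths where

  open import Defs hiding (sym)
  open import Data.Nat using (ℕ; zero; suc; _+_; _*_; _∸_; _≤_; _<_; ∣_-_∣; z≤n; s≤s; _<?_)
  open import Data.Nat.Properties hiding (_≟_)
  open import Data.Nat.Tactic.RingSolver using (solve-∀)
  open import Algebra.Properties.CommutativeSemigroup +-commutativeSemigroup using (interchange)
  open import Algebra.Properties.CommutativeMonoid.Sum +-0-commutativeMonoid
    using (sum; sum-syntax; sum-cong-≗; ∑-distrib-+; ∑-comm; sum-permute; sum-init-last)
  open import Data.Bool using (true; false; if_then_else_)
  open import Data.Bool.Properties using (_≟_)
  open import Data.Fin as Fin using (Fin; toℕ)
  open import Data.Fin.Properties using (toℕ-injective; toℕ-inject₁; toℕ-fromℕ; toℕ<n)
  open import Data.Fin.Permutation using (Permutation′; _⟨$⟩ʳ_)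
  open import Data.List using (List; []; _∷_; _++_; map; filter; concatMap; allFin; tabulate; length)
  open import Data.List.Properties using (map-++; map-tabulate; map-cong; map-∘)
  import Data.Nat.ListAction as List
  open import Data.Nat.ListAction.Properties using (sum-++)
  open import Data.Product using (_×_; _,_; proj₁; proj₂)
  open import Relation.Nullary using (yes; no; does; contradiction)
  open import Relation.Nullary.Decidable using (_×-dec_; dec-true; dec-false)
  open import Relation.Unary using (Decidable)
  open import Relation.Binary.Definitions using (tri<; tri≈; tri>)
  open import Relation.Binary.PropositionalEquality
  open import Function using (_∘_; id)

  sum-map-≤-split : ∀ {A : Set} t (f : A → ℕ) xs →
    List.sum (map f xs) ≤ length xs * t + List.sum (map (λ x → f x ∸ t) xs)
  sum-map-≤-split t f [] = z≤n
  sum-map-≤-split t f (x ∷ xs) = begin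
    f x + List.sum (map f xs)
      ≤⟨ +-mono-≤ (m≤n+m∸n (f x) t) (sum-map-≤-split t f xs) ⟩
    (t + (f x ∸ t)) + (length xs * t + List.sum (map (λ x → f x ∸ t) xs))
      ≡⟨ interchange t (f x ∸ t) (length xs * t) _ ⟩
    (t + length xs * t) + ((f x ∸ t) + List.sum (map (λ x → f x ∸ t) xs)) ∎
    where open ≤-Reasoning

  sum-map-filter-mono : ∀ {A : Set} {P Q : A → Set} (P? : Decidable P) (Q? : Decidable Q) →
    (∀ {x} → P x → Q x) → ∀ (f : A → ℕ) xs →
    List.sum (map f (filter P? xs)) ≤ List.sum (map f (filter Q? xs))
  sum-map-filter-mono P? Q? P⇒Q f [] = z≤n
  sum-map-filter-mono P? Q? P⇒Q f (x ∷ xs) with P? x | Q? x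
  ... | yes _  | yes _  = +-monoʳ-≤ (f x) (sum-map-filter-mono P? Q? P⇒Q f xs)
  ... | yes Px | no ¬Qx = contradiction (P⇒Q Px) ¬Qx
  ... | no _   | yes _  = ≤-trans (sum-map-filter-mono P? Q? P⇒Q f xs) (m≤n+m _ (f x))
  ... | no _   | no _   = sum-map-filter-mono P? Q? P⇒Q f xs

  sum-map-filter : ∀ {A : Set} {P : A → Set} (P? : Decidable P) (f : A → ℕ) xs →
    List.sum (map f (filter P? xs)) ≡ List.sum (map (λ x → if does (P? x) then f x else 0) xs)
  sum-map-filter P? f [] = refl
  sum-map-filter P? f (x ∷ xs) with does (P? x)
  ... | true  = cong (f x +_) (sum-map-filter P? f xs)
  ... | false = sum-map-filter P? f xs

  sum-map-concatMap : ∀ {A B : Set} (g : B → ℕ) (h : A → List B) xs →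
    List.sum (map g (concatMap h xs)) ≡ List.sum (map (λ x → List.sum (map g (h x))) xs)
  sum-map-concatMap g h [] = refl
  sum-map-concatMap g h (x ∷ xs) = begin
    List.sum (map g (h x ++ concatMap h xs))
      ≡⟨ cong List.sum (map-++ g (h x) (concatMap h xs)) ⟩
    List.sum (map g (h x) ++ map g (concatMap h xs))
      ≡⟨ sum-++ (map g (h x)) (map g (concatMap h xs)) ⟩
    List.sum (map g (h x)) + List.sum (map g (concatMap h xs))
      ≡⟨ cong (List.sum (map g (h x)) +_) (sum-map-concatMap g h xs) ⟩
    List.sum (map g (h x)) + List.sum (map (λ x → List.sum (map g (h x))) xs) ∎
    where open ≡-Reasoning

  sum-tabulate : ∀ {n} (f : Fin n → ℕ) → List.sum (tabulate f) ≡ ∑[ i < n ] f i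
  sum-tabulate {zero}  f = refl
  sum-tabulate {suc n} f = cong (f Fin.zero +_) (sum-tabulate (f ∘ Fin.suc))

  sum-map-allFin : ∀ {n} (f : Fin n → ℕ) → List.sum (map f (allFin n)) ≡ ∑[ i < n ] f i
  sum-map-allFin f = trans (cong List.sum (map-tabulate id f)) (sum-tabulate f)

  allPairs : ∀ n → List (Fin n × Fin n)
  allPairs n = concatMap (λ i → map (λ j → (i , j)) (allFin n)) (allFin n)

  sum-map-allPairs : ∀ {n} (g : Fin n × Fin n → ℕ) →
    List.sum (map g (allPairs n)) ≡ ∑[ i < n ] ∑[ j < n ] g (i , j)
  sum-map-allPairs {n} g = begin
    List.sum (map g (allPairs n))
      ≡⟨ sum-map-concatMap g (λ i → map (i ,_) (allFin n)) (allFin n) ⟩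
    List.sum (map (λ i → List.sum (map g (map (i ,_) (allFin n)))) (allFin n))
      ≡⟨ cong List.sum (map-cong (λ i → cong List.sum (sym (map-∘ (allFin n)))) (allFin n)) ⟩
    List.sum (map (λ i → List.sum (map (λ j → g (i , j)) (allFin n))) (allFin n))
      ≡⟨ cong List.sum (map-cong (λ i → sum-map-allFin (λ j → g (i , j))) (allFin n)) ⟩
    List.sum (map (λ i → ∑[ j < n ] g (i , j)) (allFin n))
      ≡⟨ sum-map-allFin (λ i → ∑[ j < n ] g (i , j)) ⟩
    ∑[ i < n ] ∑[ j < n ] g (i , j) ∎
    where open ≡-Reasoning

  strictlyUpper : ∀ {n} → (Fin n → Fin n → ℕ) → Fin n → Fin n → ℕ
  strictlyUpper h i j = if does (toℕ i <? toℕ j) then h i j else 0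

  strictlyUpper-+-transpose : ∀ {n} (h : Fin n → Fin n → ℕ) → (∀ i j → h i j ≡ h j i) →
    (∀ i → h i i ≡ 0) → ∀ i j → h i j ≡ strictlyUpper h i j + strictlyUpper h j i
  strictlyUpper-+-transpose h h-sym h-diag i j with <-cmp (toℕ i) (toℕ j)
  ... | tri< i<j _ _ rewrite dec-true (toℕ i <? toℕ j) i<j | dec-false (toℕ j <? toℕ i) (<-asym i<j) =
    sym (+-identityʳ (h i j))
  ... | tri> _ _ j<i rewrite dec-true (toℕ j <? toℕ i) j<i | dec-false (toℕ i <? toℕ j) (<-asym j<i) =
    h-sym i j
  ... | tri≈ _ i≡j _ rewrite toℕ-injective i≡j | dec-false (toℕ j <? toℕ j) (<-irrefl refl) =
    h-diag j

  ∑∑-symmetric : ∀ {n} (h : Fin n → Fin n → ℕ) → (∀ i j → h i j ≡ h j i) → (∀ i → h i i ≡ 0) →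
    ∑[ i < n ] ∑[ j < n ] h i j ≡ 2 * ∑[ i < n ] ∑[ j < n ] strictlyUpper h i j
  ∑∑-symmetric {n} h h-sym h-diag = begin
    ∑[ i < n ] ∑[ j < n ] h i j
      ≡⟨ sum-cong-≗ (λ i → sum-cong-≗ (strictlyUpper-+-transpose h h-sym h-diag i)) ⟩
    ∑[ i < n ] ∑[ j < n ] (U i j + U j i)
      ≡⟨ sum-cong-≗ (λ i → ∑-distrib-+ (U i) (λ j → U j i)) ⟩
    ∑[ i < n ] (∑[ j < n ] U i j + ∑[ j < n ] U j i)
      ≡⟨ ∑-distrib-+ (λ i → ∑[ j < n ] U i j) (λ i → ∑[ j < n ] U j i) ⟩
    ∑[ i < n ] ∑[ j < n ] U i j + ∑[ i < n ] ∑[ j < n ] U j i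
      ≡⟨ cong (∑[ i < n ] ∑[ j < n ] U i j +_) (trans (∑-comm (λ i j → U j i)) (sym (+-identityʳ _))) ⟩
    2 * ∑[ i < n ] ∑[ j < n ] U i j ∎
    where
    open ≡-Reasoning
    U : Fin n → Fin n → ℕ
    U = strictlyUpper h

  ∑∑-permute : ∀ {n} (g : Fin n → Fin n → ℕ) (π : Permutation′ n) →
    ∑[ i < n ] ∑[ j < n ] g (π ⟨$⟩ʳ i) (π ⟨$⟩ʳ j) ≡ ∑[ a < n ] ∑[ b < n ] g a b
  ∑∑-permute g π = trans (sum-cong-≗ (λ i → sym (sum-permute (g (π ⟨$⟩ʳ i)) π)))
                         (sym (sum-permute (λ a → sum (g a)) π))

  ∑-last : ∀ k (F : ℕ → ℕ) → ∑[ a < suc k ] F (toℕ a) ≡ ∑[ a < k ] F (toℕ a) + F k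
  ∑-last k F = trans (sum-init-last (F ∘ toℕ))
    (cong₂ _+_ (sum-cong-≗ {k} (cong F ∘ toℕ-inject₁)) (cong F (toℕ-fromℕ k)))

  excess : ℕ → ℕ → ℕ → ℕ
  excess t a b = ∣ a - b ∣ ∸ t

  excess-comm : ∀ t a b → excess t a b ≡ excess t b a
  excess-comm t a b = cong (_∸ t) (∣-∣-comm a b)

  excess-self : ∀ t a → excess t a a ≡ 0
  excess-self t a = trans (cong (_∸ t) (∣n-n∣≡0 a)) (0∸n≡0 t)

  excessSum : ℕ → ℕ → ℕ
  excessSum t k = ∑[ a < k ] ∑[ b < k ] excess t (toℕ a) (toℕ b)

  -- Written with k ∸ a rather than ∣ a - k ∣ so that excessTo t (suc k) unfolds
  -- definitionally to (suc k ∸ t) + excessTo t k.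
  excessTo : ℕ → ℕ → ℕ
  excessTo t k = ∑[ a < k ] (k ∸ toℕ a ∸ t)

  excessTo-column : ∀ t k → ∑[ a < k ] excess t (toℕ a) k ≡ excessTo t k
  excessTo-column t k = sum-cong-≗ {k} (λ a → cong (_∸ t) (m≤n⇒∣m-n∣≡n∸m (<⇒≤ (toℕ<n a))))

  excessTo-row : ∀ t k → ∑[ b < k ] excess t k (toℕ b) ≡ excessTo t k
  excessTo-row t k = trans (sum-cong-≗ {k} (λ b → excess-comm t k (toℕ b))) (excessTo-column t k)

  excessTo-≤ : ∀ t k → k ≤ t → excessTo t k ≡ 0
  excessTo-≤ t zero    _     = refl
  excessTo-≤ t (suc k) 1+k≤t = cong₂ _+_ (m≤n⇒m∸n≡0 1+k≤t) (excessTo-≤ t k (<⇒≤ 1+k≤t))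

  excessTo-closedForm : ∀ t u → 2 * excessTo t (t + u) ≡ u * (u + 1)
  excessTo-closedForm t zero = cong (2 *_) (excessTo-≤ t (t + 0) (≤-reflexive (+-identityʳ t)))
  excessTo-closedForm t (suc u) = begin
    2 * excessTo t (t + suc u)                 ≡⟨ cong (λ k → 2 * excessTo t k) (+-suc t u) ⟩
    2 * (suc (t + u) ∸ t + excessTo t (t + u)) ≡⟨ cong (λ d → 2 * (d + excessTo t (t + u))) top ⟩
    2 * (suc u + excessTo t (t + u))           ≡⟨ *-distribˡ-+ 2 (suc u) _ ⟩
    2 * suc u + 2 * excessTo t (t + u)         ≡⟨ cong (2 * suc u +_) (excessTo-closedForm t u) ⟩
    2 * suc u + u * (u + 1)                    ≡⟨ triangular-step u ⟩
    suc u * (suc u + 1)                        ∎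
    where
    open ≡-Reasoning
    top : suc (t + u) ∸ t ≡ suc u
    top = trans (+-∸-assoc 1 (m≤m+n t u)) (cong suc (m+n∸m≡n t u))
    triangular-step : ∀ x → 2 * suc x + x * (x + 1) ≡ suc x * (suc x + 1)
    triangular-step = solve-∀

  excessSum-suc : ∀ t k → excessSum t (suc k) ≡ excessSum t k + 2 * excessTo t k
  excessSum-suc t k = begin
    ∑[ a < suc k ] ∑[ b < suc k ] h (toℕ a) (toℕ b)
      ≡⟨ ∑-last k (λ a → ∑[ b < suc k ] h a (toℕ b)) ⟩
    ∑[ a < k ] ∑[ b < suc k ] h (toℕ a) (toℕ b) + ∑[ b < suc k ] h k (toℕ b)
      ≡⟨ cong₂ _+_ (sum-cong-≗ {k} (λ a → ∑-last k (h (toℕ a)))) (∑-last k (h k)) ⟩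
    ∑[ a < k ] (∑[ b < k ] h (toℕ a) (toℕ b) + h (toℕ a) k) + (∑[ b < k ] h k (toℕ b) + h k k)
      ≡⟨ cong₂ _+_ (∑-distrib-+ {k} (λ a → ∑[ b < k ] h (toℕ a) (toℕ b)) (λ a → h (toℕ a) k))
                   (cong₂ _+_ (excessTo-row t k) (excess-self t k)) ⟩
    excessSum t k + ∑[ a < k ] h (toℕ a) k + (excessTo t k + 0)
      ≡⟨ cong (λ c → excessSum t k + c + (excessTo t k + 0)) (excessTo-column t k) ⟩
    excessSum t k + excessTo t k + (excessTo t k + 0)
      ≡⟨ +-assoc (excessSum t k) _ _ ⟩
    excessSum t k + 2 * excessTo t k ∎
    where
    open ≡-Reasoning
    h : ℕ → ℕ → ℕ
    h = excess t

  excessSum-≤ : ∀ t k → k ≤ suc t → excessSum t k ≡ 0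
  excessSum-≤ t zero    _         = refl
  excessSum-≤ t (suc k) (s≤s k≤t) = trans (excessSum-suc t k)
    (cong₂ (λ a b → a + 2 * b) (excessSum-≤ t k (m≤n⇒m≤1+n k≤t)) (excessTo-≤ t k k≤t))

  excessSum-closedForm : ∀ t u → 3 * excessSum t (suc t + u) ≡ u * (u + 1) * (u + 2)
  excessSum-closedForm t zero =
    cong (3 *_) (excessSum-≤ t (suc t + 0) (≤-reflexive (cong suc (+-identityʳ t))))
  excessSum-closedForm t (suc u) = begin
    3 * excessSum t (suc t + suc u)
      ≡⟨ cong (λ k → 3 * excessSum t k) (+-suc (suc t) u) ⟩
    3 * excessSum t (suc (suc t + u))
      ≡⟨ cong (3 *_) (excessSum-suc t (suc t + u)) ⟩
    3 * (excessSum t (suc t + u) + 2 * excessTo t (suc t + u))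
      ≡⟨ *-distribˡ-+ 3 (excessSum t (suc t + u)) _ ⟩
    3 * excessSum t (suc t + u) + 3 * (2 * excessTo t (suc t + u))
      ≡⟨ cong₂ (λ a b → a + 3 * b) (excessSum-closedForm t u)
               (trans (cong (λ k → 2 * excessTo t k) (sym (+-suc t u))) (excessTo-closedForm t (suc u))) ⟩
    u * (u + 1) * (u + 2) + 3 * (suc u * (suc u + 1))
      ≡⟨ tetrahedral-step u ⟩
    suc u * (suc u + 1) * (suc u + 2) ∎
    where
    open ≡-Reasoning
    tetrahedral-step : ∀ x →
      x * (x + 1) * (x + 2) + 3 * (suc x * (suc x + 1)) ≡ suc x * (suc x + 1) * (suc x + 2)
    tetrahedral-step = solve-∀

  edgeLength : ∀ {n} → LinearArrangement n → Fin n × Fin n → ℕ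
  edgeLength π (i , j) = ∣ toℕ (π ⟨$⟩ʳ i) - toℕ (π ⟨$⟩ʳ j) ∣

  ordered? : ∀ {n} → Decidable (λ (p : Fin n × Fin n) → toℕ (proj₁ p) < toℕ (proj₂ p))
  ordered? (i , j) = toℕ i <? toℕ j

  -- edges G is filter (isEdge? G) (allPairs n) by refl.
  isEdge? : ∀ {n} (G : SimpleGraph n) →
    Decidable (λ (p : Fin n × Fin n) → toℕ (proj₁ p) < toℕ (proj₂ p) × adj G (proj₁ p) (proj₂ p) ≡ true)
  isEdge? G (i , j) = (toℕ i <? toℕ j) ×-dec (adj G i j ≟ true)

  sum-edges≤sum-orderedPairs : ∀ {n} (G : SimpleGraph n) (f : Fin n × Fin n → ℕ) →
    List.sum (map f (edges G)) ≤ List.sum (map f (filter ordered? (allPairs n)))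
  sum-edges≤sum-orderedPairs {n} G f = sum-map-filter-mono (isEdge? G) ordered? proj₁ f (allPairs n)

  sum-orderedPairs : ∀ {n} (h : Fin n → Fin n → ℕ) →
    List.sum (map (λ p → h (proj₁ p) (proj₂ p)) (filter ordered? (allPairs n)))
    ≡ ∑[ i < n ] ∑[ j < n ] strictlyUpper h i j
  sum-orderedPairs {n} h = trans (sum-map-filter ordered? (λ p → h (proj₁ p) (proj₂ p)) (allPairs n))
                                 (sum-map-allPairs (λ p → strictlyUpper h (proj₁ p) (proj₂ p)))

  sumEdgeLengths-bound : ∀ t u (G : SimpleGraph (suc t + u)) (π : LinearArrangement (suc t + u)) →
    6 * sumEdgeLengths G π ≤ 6 * (numEdges G * t) + u * (u + 1) * (u + 2)
  sumEdgeLengths-bound t u G π = begin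
    6 * sumEdgeLengths G π
      ≤⟨ *-monoʳ-≤ 6 (sum-map-≤-split t (edgeLength π) (edges G)) ⟩
    6 * (m * t + List.sum (map (λ p → X (proj₁ p) (proj₂ p)) (edges G)))
      ≤⟨ *-monoʳ-≤ 6 (+-monoʳ-≤ (m * t) (sum-edges≤sum-orderedPairs G (λ p → X (proj₁ p) (proj₂ p)))) ⟩
    6 * (m * t + List.sum (map (λ p → X (proj₁ p) (proj₂ p)) (filter ordered? (allPairs n))))
      ≡⟨ cong (λ s → 6 * (m * t + s)) (sum-orderedPairs X) ⟩
    6 * (m * t + ∑[ i < n ] ∑[ j < n ] strictlyUpper X i j)
      ≡⟨ *-distribˡ-+ 6 (m * t) _ ⟩
    6 * (m * t) + 6 * ∑[ i < n ] ∑[ j < n ] strictlyUpper X i j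
      ≡⟨ cong (6 * (m * t) +_) (*-assoc 3 2 (∑[ i < n ] ∑[ j < n ] strictlyUpper X i j)) ⟩
    6 * (m * t) + 3 * (2 * ∑[ i < n ] ∑[ j < n ] strictlyUpper X i j)
      ≡⟨ cong (λ s → 6 * (m * t) + 3 * s) (sym (∑∑-symmetric X X-sym X-diag)) ⟩
    6 * (m * t) + 3 * ∑[ i < n ] ∑[ j < n ] X i j
      ≡⟨ cong (λ s → 6 * (m * t) + 3 * s) (∑∑-permute (λ a b → excess t (toℕ a) (toℕ b)) π) ⟩
    6 * (m * t) + 3 * excessSum t n
      ≡⟨ cong (6 * (m * t) +_) (excessSum-closedForm t u) ⟩
    6 * (m * t) + u * (u + 1) * (u + 2) ∎
    where
    open ≤-Reasoning
    n : ℕ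
    n = suc t + u
    m : ℕ
    m = numEdges G
    X : Fin n → Fin n → ℕ
    X i j = excess t (toℕ (π ⟨$⟩ʳ i)) (toℕ (π ⟨$⟩ʳ j))
    X-sym : ∀ i j → X i j ≡ X j i
    X-sym i j = excess-comm t (toℕ (π ⟨$⟩ʳ i)) (toℕ (π ⟨$⟩ʳ j))
    X-diag : ∀ i → X i i ≡ 0
    X-diag i = excess-self t (toℕ (π ⟨$⟩ʳ i))

open import Defs hiding (sym)
open import Data.Nat using (ℕ; _≤_; suc; _+_; s≤s)
open import Data.Nat.Combinatorics using (_C_)
open import Data.Product using (_×_; _,_)
open import Data.Rational using (_*_; 0ℚ; _/_) renaming (_≤_ to _≤ℚ_)
open import Data.Integer using (+_)
open import Relation.Binary.PropositionalEquality using (_≡_; refl; sym; subst)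
open Threshold using (dStar-split)
open ClosedForm using (ℕtoℚ-≤-sixth; DupperEM-closedForm; DupperEM-empty; DupperEM-complete)
open EdgeLengths using (sumEdgeLengths-bound)

sumEdgeLengths≤DupperEM : ∀ {n m} t u → n ≡ suc t + u → dStar n m ≡ suc t →
  (G : SimpleGraph n) → numEdges G ≡ m → (π : LinearArrangement n) →
  ℕtoℚ (sumEdgeLengths G π) ≤ℚ DupperEM n m
sumEdgeLengths≤DupperEM t u refl d≡ G refl π =
  subst (ℕtoℚ (sumEdgeLengths G π) ≤ℚ_) (sym (DupperEM-closedForm (numEdges G) t u refl d≡))
        (ℕtoℚ-≤-sixth (sumEdgeLengths G π) (sumEdgeLengths-bound t u G π))

mainTheorem11 : (n : ℕ) → 1 ≤ n →
    ((m : ℕ) → m ≤ n C 2 → (G : SimpleGraph n) → numEdges G ≡ m →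
       (π : LinearArrangement n) → ℕtoℚ (sumEdgeLengths G π) ≤ℚ DupperEM n m)
    × (DupperEM n 0 ≡ 0ℚ)
    × (DupperEM n (n C 2) ≡ (+ 1 / 6) * ℕtoℚ (ℕ.suc n) * ℕtoℚ n * ℕtoℚ (n Data.Nat.∸ 1))
mainTheorem11 (suc k) (s≤s _) =
  (λ m m≤C → let t , u , d≡ , n≡ = dStar-split k m m≤C in sumEdgeLengths≤DupperEM t u n≡ d≡)
  , DupperEM-empty k
  , DupperEM-complete k
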